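{- Let $d_{n,i}$ be the number of elements of length $i$ in $\mathrm{Div}(\Delta_n)$ (with $d_{n,i}=0$ for $i<0$ or $i>n(n-1)/2$). Then for each $n$ the sequence $(d_{n,i})_{i=0,\dots,n(n-1)/2}$ is symmetric, i.e. $d_{n,i}=d_{n,n(n-1)/2-i}$, and unimodal, and it satisfies the recurrence: (a) $d_{1,0}=1$ and $d_{1,i}=0$ for $i\ne 0$; (b) $d_{n+1,i}=d_{n,i}+d_{n,i-1}+\cdots+d_{n,i-n}$ for all $n\ge 1$ and all $i$.
   Context: The monoid of positive $n$-braids $\mathcal{MB}_n$ is the monoid with generators $x_1,\dots,x_{n-1}$ and relations $x_ix_j=x_jx_i$ for $|i-j|\ge 2$ and $x_ix_{i+1}x_i=x_{i+1}x_ix_{i+1}$ for $1\le i\le n-2$ (for $n=1$ it is trivial); word length is well defined on it. The Garside braid is $\Delta_n=x_1(x_2x_1)\cdots(x_{n-1}x_{n-2}\cdots x_1)$ ($\Delta_1$ is the identity). $\mathrm{Div}(\Delta_n)=\{\omega\in\mathcal{MB}_n : \Delta_n=\alpha\omega\beta \text{ for some } \alpha,\beta\in\mathcal{MB}_n\}$. Unimodal means weakly increasing up to some index and weakly decreasing afterwards. -}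

module Defs where

open import Data.Nat using (ℕ; zero; suc; _+_; _*_; _∸_; _≤_; _≤ᵇ_)
open import Data.Nat.DivMod using (_/_)
open import Data.Fin using (Fin; toℕ; fromℕ; inject₁)
open import Data.List using (List; []; _∷_; _++_; map; length; upTo)
open import Data.Nat.ListAction using (sum)
open import Data.Vec using (Vec; lookup)
open import Data.List.Relation.Unary.All using (All)
open import Data.Bool using (if_then_else_)
open import Data.Product using (Σ; ∃; _×_)
open import Relation.Binary.PropositionalEquality using (_≡_)

-- Words in the generators of the positive braid monoid on n strands.
-- The generator x_i (1 ≤ i ≤ n-1) is the element of Fin (n ∸ 1) with toℕ = i - 1.
Word : ℕ → Set
Word n = List (Fin (n ∸ 1))

data BraidRel {k : ℕ} : List (Fin k) → List (Fin k) → Set where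
  comm  : (a b : Fin k) → suc (suc (toℕ a)) ≤ toℕ b →
          BraidRel (a ∷ b ∷ []) (b ∷ a ∷ [])
  braid : (a b : Fin k) → toℕ b ≡ suc (toℕ a) →
          BraidRel (a ∷ b ∷ a ∷ []) (b ∷ a ∷ b ∷ [])

data _≈_ {k : ℕ} : List (Fin k) → List (Fin k) → Set where
  step   : (u v : List (Fin k)) {l r : List (Fin k)} → BraidRel l r →
           (u ++ l ++ v) ≈ (u ++ r ++ v)
  ≈refl  : {w : List (Fin k)} → w ≈ w
  ≈sym   : {w w′ : List (Fin k)} → w ≈ w′ → w′ ≈ w
  ≈trans : {w w′ w″ : List (Fin k)} → w ≈ w′ → w′ ≈ w″ → w ≈ w″

-- down k = x_k x_{k-1} ... x_1  (as a word over k generators)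
down : (k : ℕ) → List (Fin k)
down zero    = []
down (suc k) = fromℕ k ∷ map inject₁ (down k)

-- Δ over k generators: x_1 (x_2 x_1) ... (x_k ... x_1)
Δ′ : (k : ℕ) → List (Fin k)
Δ′ zero    = []
Δ′ (suc k) = map inject₁ (Δ′ k) ++ down (suc k)

-- Garside braid Δ_n (n strands, n ∸ 1 generators); Δ_1 = Δ_0 = identity.
Δ : (n : ℕ) → Word n
Δ n = Δ′ (n ∸ 1)

DivΔ : (n : ℕ) → Word n → Set
DivΔ n ω = Σ (Word n) λ α → Σ (Word n) λ β → (α ++ ω ++ β) ≈ Δ n

-- c is the number of elements of length i of Div(Δ_n):
-- a list of c representatives (words of length i in Div(Δ_n)),
-- pairwise distinct in MB_n, such that every such word equals one of them in MB_n.
IsDivCount : (n i c : ℕ) → Set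
IsDivCount n i c =
  Σ (Vec (Word n) c) λ reps →
      ((j : Fin c) → (length (lookup reps j) ≡ i) × DivΔ n (lookup reps j))
    × ((j j′ : Fin c) → lookup reps j ≈ lookup reps j′ → j ≡ j′)
    × ((ω : Word n) → length ω ≡ i → DivΔ n ω → ∃ λ j → ω ≈ lookup reps j)

-- top n = n(n-1)/2 = length of Δ_n
top : ℕ → ℕ
top n = (n * (n ∸ 1)) / 2

-- f (i - k) with the convention f (negative) = 0
shiftZ : (ℕ → ℕ) → ℕ → ℕ → ℕ
shiftZ f i k = if k ≤ᵇ i then f (i ∸ k) else 0

windowSum : (ℕ → ℕ) → ℕ → ℕ → ℕ
windowSum f i m = sum (map (shiftZ f i) (upTo (suc m)))

UnimodalUpTo : (ℕ → ℕ) → ℕ → Set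
UnimodalUpTo f N = Σ ℕ λ m →
    ((i j : ℕ) → i ≤ j → j ≤ m → f i ≤ f j)
  × ((i j : ℕ) → m ≤ i → i ≤ j → j ≤ N → f j ≤ f i)

module Submission where

-- Positive words act on lists of strands by adjacent swaps; equal braids act identically
-- (≈-act), and a word is *reduced* when its permutation has as many inversions as the
-- word has letters. Δ is reduced (Reduced-Δ), and factors of reduced
-- words are reduced, so every divisor of Δ is reduced.
--
-- Normal form: every reduced word over g+1 generators equals  s · x_{g+1} x_g ⋯ x_{g+2-j}
-- for a word s over g generators and 0 ≤ j ≤ g+1 (normalForm-of); conversely every such
-- word with s a divisor is a divisor (Δ-prefix), and the permutation of a normal form
-- determines j and the permutation of s (perm-normal-injective).
--
-- Hence the length-i divisors over g+1 generators correspond to pairs (j, divisor of length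
-- i-j over g generators), which gives the recurrence d_{n+1,i} = d_{n,i} + ⋯ + d_{n,i-n}.
-- Finally, window sums preserve "symmetric and rising to the middle" (WindowSum), which
-- yields symmetry and unimodality by induction on n.

open import Defs
open import Data.Nat
open import Data.Nat.Properties
open import Data.Nat.DivMod using (_/_; +-distrib-/-∣ʳ; m*n/n≡m)
open import Data.Nat.Divisibility using (n∣m*n)
open import Data.Nat.ListAction using (sum)
open import Data.Nat.Tactic.RingSolver using (solve-∀)
open import Algebra.Properties.CommutativeSemigroup +-commutativeSemigroup using (x∙yz≈y∙xz)
open import Data.Bool using (true; false; T)
open import Data.Unit using (tt)
open import Data.List using (List; []; _∷_; _++_; map; length; [_]; applyUpTo)
open import Data.List.Properties using (length-++; length-map; ++-assoc; map-++; ++-identityʳ; ∷-injective; ∷-injectiveʳ)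
open import Data.List.Reverse using (Reverse; []; _∶_∶ʳ_; reverseView)
open import Data.List.Relation.Unary.All as All using (All; []; _∷_)
open import Data.List.Relation.Unary.All.Properties as All using ()
open import Data.Vec using (tabulate; lookup)
open import Data.Vec.Properties using (lookup∘tabulate)
open import Data.Fin using (Fin; toℕ; fromℕ; inject₁; lower₁; fromℕ<; splitAt; _↑ˡ_; _↑ʳ_)
  renaming (zero to fzero; suc to fsuc)
open import Data.Fin.Properties
  using (toℕ<n; toℕ-inject₁; toℕ-fromℕ; toℕ-fromℕ<; toℕ-injective; inject₁-lower₁;
         splitAt-↑ˡ; splitAt-↑ʳ; splitAt⁻¹-↑ˡ; splitAt⁻¹-↑ʳ)
open import Data.Product using (Σ; ∃; ∃₂; _×_; _,_; proj₁; proj₂)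
open import Data.Sum using (_⊎_; inj₁; inj₂; [_,_]′)
open import Data.Empty using (⊥-elim)
open import Function using (_∘_)
open import Relation.Nullary using (¬_; yes; no)
open import Relation.Binary using (tri<; tri≈; tri>)
open import Relation.Binary.PropositionalEquality hiding ([_])

swapAt : ℕ → List ℕ → List ℕ
swapAt zero    (x ∷ y ∷ L) = y ∷ x ∷ L
swapAt zero    L           = L
swapAt (suc p) []          = []
swapAt (suc p) (x ∷ L)     = x ∷ swapAt p L

act : ∀ {k} → List (Fin k) → List ℕ → List ℕ
act []      L = L
act (a ∷ w) L = act w (swapAt (toℕ a) L)

act-++ : ∀ {k} (u v : List (Fin k)) L → act (u ++ v) L ≡ act v (act u L)
act-++ []      v L = refl
act-++ (a ∷ u) v L = act-++ u v (swapAt (toℕ a) L)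

length-swapAt : ∀ p L → length (swapAt p L) ≡ length L
length-swapAt zero    []          = refl
length-swapAt zero    (x ∷ [])    = refl
length-swapAt zero    (x ∷ y ∷ L) = refl
length-swapAt (suc p) []          = refl
length-swapAt (suc p) (x ∷ L)     = cong suc (length-swapAt p L)

length-act : ∀ {k} (w : List (Fin k)) L → length (act w L) ≡ length L
length-act []      L = refl
length-act (a ∷ w) L = trans (length-act w _) (length-swapAt (toℕ a) L)

swapAt-comm : ∀ a b L → 2 + a ≤ b → swapAt a (swapAt b L) ≡ swapAt b (swapAt a L)
swapAt-comm zero    (suc zero)    L           (s≤s ())
swapAt-comm zero    (suc (suc b)) []          _         = refl
swapAt-comm zero    (suc (suc b)) (x ∷ [])    _         = refl
swapAt-comm zero    (suc (suc b)) (x ∷ y ∷ L) _         = refl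
swapAt-comm (suc a) (suc b)       []          _         = refl
swapAt-comm (suc a) (suc b)       (x ∷ L)     (s≤s a≤b) = cong (x ∷_) (swapAt-comm a b L a≤b)

swapAt-braid : ∀ a L → 2 + a < length L →
  swapAt a (swapAt (suc a) (swapAt a L)) ≡ swapAt (suc a) (swapAt a (swapAt (suc a) L))
swapAt-braid zero    (x ∷ y ∷ z ∷ L) _                 = refl
swapAt-braid zero    (x ∷ [])        (s≤s ())
swapAt-braid zero    (x ∷ y ∷ [])    (s≤s (s≤s ()))
swapAt-braid (suc a) (x ∷ L)         (s≤s a<L) = cong (x ∷_) (swapAt-braid a L a<L)

-- Each generator acts as an involution; this is why x_a x_a is never reduced.
swapAt-involutive : ∀ p L → swapAt p (swapAt p L) ≡ L
swapAt-involutive zero    []          = refl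
swapAt-involutive zero    (x ∷ [])    = refl
swapAt-involutive zero    (x ∷ y ∷ L) = refl
swapAt-involutive (suc p) []          = refl
swapAt-involutive (suc p) (x ∷ L)     = cong (x ∷_) (swapAt-involutive p L)

braidRel-act : ∀ {k} {l r : List (Fin k)} → BraidRel l r →
  ∀ L → length L ≡ suc k → act l L ≡ act r L
braidRel-act (comm a b a≤b) L _ = sym (swapAt-comm (toℕ a) (toℕ b) L a≤b)
braidRel-act {k} (braid a b b≡a+1) L len rewrite b≡a+1 =
  swapAt-braid (toℕ a) L (subst (λ n → 2 + toℕ a < n) (sym len) (s≤s (subst (_< k) b≡a+1 (toℕ<n b))))

-- ... hence equal braids act identically: this is the invariant separating distinct braids.
≈-act : ∀ {k} {w w′ : List (Fin k)} → w ≈ w′ → ∀ L → length L ≡ suc k → act w L ≡ act w′ L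
≈-act (step u v {l} {r} rel) L len = begin
    act (u ++ l ++ v) L       ≡⟨ act-++ u (l ++ v) L ⟩
    act (l ++ v) (act u L)    ≡⟨ act-++ l v _ ⟩
    act v (act l (act u L))   ≡⟨ cong (act v) (braidRel-act rel (act u L) (trans (length-act u L) len)) ⟩
    act v (act r (act u L))   ≡⟨ sym (act-++ r v _) ⟩
    act (r ++ v) (act u L)    ≡⟨ sym (act-++ u (r ++ v) L) ⟩
    act (u ++ r ++ v) L       ∎
  where open ≡-Reasoning
≈-act ≈refl         L len = refl
≈-act (≈sym p)      L len = sym (≈-act p L len)
≈-act (≈trans p q)  L len = trans (≈-act p L len) (≈-act q L len)

-- The relations are homogeneous, so word length is an invariant of braids.
≈-length : ∀ {k} {w w′ : List (Fin k)} → w ≈ w′ → length w ≡ length w′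
≈-length (step u v {l} {r} rel) = begin
    length (u ++ l ++ v)                 ≡⟨ length-++ u ⟩
    length u + length (l ++ v)           ≡⟨ cong (length u +_) (length-++ l) ⟩
    length u + (length l + length v)     ≡⟨ cong (λ n → length u + (n + length v)) (relLength rel) ⟩
    length u + (length r + length v)     ≡⟨ cong (length u +_) (sym (length-++ r)) ⟩
    length u + length (r ++ v)           ≡⟨ sym (length-++ u) ⟩
    length (u ++ r ++ v)                 ∎
  where
    open ≡-Reasoning
    relLength : ∀ {l r} → BraidRel l r → length l ≡ length r
    relLength (comm _ _ _)  = refl
    relLength (braid _ _ _) = refl
≈-length ≈refl        = refl
≈-length (≈sym p)     = sym (≈-length p)
≈-length (≈trans p q) = trans (≈-length p) (≈-length q)

ltBit : ℕ → ℕ → ℕ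
ltBit _       zero    = 0
ltBit zero    (suc x) = 1
ltBit (suc y) (suc x) = ltBit y x

eqBit : ℕ → ℕ → ℕ
eqBit zero    zero    = 1
eqBit zero    (suc _) = 0
eqBit (suc _) zero    = 0
eqBit (suc c) (suc y) = eqBit c y

countBelow : ℕ → List ℕ → ℕ
countBelow x []      = 0
countBelow x (y ∷ L) = ltBit y x + countBelow x L

countEq : ℕ → List ℕ → ℕ
countEq c []      = 0
countEq c (y ∷ L) = eqBit c y + countEq c L

inversions : List ℕ → ℕ
inversions []      = 0
inversions (x ∷ L) = countBelow x L + inversions L

ltBit≤1 : ∀ y x → ltBit y x ≤ 1
ltBit≤1 _       zero    = z≤n
ltBit≤1 zero    (suc x) = ≤-refl
ltBit≤1 (suc y) (suc x) = ltBit≤1 y x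

ltBit-< : ∀ y x → y < x → ltBit y x ≡ 1
ltBit-< zero    (suc x) _         = refl
ltBit-< (suc y) (suc x) (s≤s y<x) = ltBit-< y x y<x

ltBit-≥ : ∀ y x → x ≤ y → ltBit y x ≡ 0
ltBit-≥ y       zero    _         = refl
ltBit-≥ (suc y) (suc x) (s≤s x≤y) = ltBit-≥ y x x≤y

ltBit-cases : ∀ y x → ltBit y x ≡ 0 ⊎ (ltBit y x ≡ 1 × y < x)
ltBit-cases _       zero    = inj₁ refl
ltBit-cases zero    (suc x) = inj₂ (refl , s≤s z≤n)
ltBit-cases (suc y) (suc x) with ltBit-cases y x
... | inj₁ e         = inj₁ e
... | inj₂ (e , y<x) = inj₂ (e , s≤s y<x)

eqBit-refl : ∀ x → eqBit x x ≡ 1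
eqBit-refl zero    = refl
eqBit-refl (suc x) = eqBit-refl x

eqBit-≢ : ∀ c y → c ≢ y → eqBit c y ≡ 0
eqBit-≢ zero    zero    c≢y = ⊥-elim (c≢y refl)
eqBit-≢ zero    (suc y) _   = refl
eqBit-≢ (suc c) zero    _   = refl
eqBit-≢ (suc c) (suc y) c≢y = eqBit-≢ c y (c≢y ∘ cong suc)

countBelow-swapAt : ∀ x p L → countBelow x (swapAt p L) ≡ countBelow x L
countBelow-swapAt x zero    []          = refl
countBelow-swapAt x zero    (y ∷ [])    = refl
countBelow-swapAt x zero    (y ∷ z ∷ L) = x∙yz≈y∙xz (ltBit z x) (ltBit y x) (countBelow x L)
countBelow-swapAt x (suc p) []          = refl
countBelow-swapAt x (suc p) (y ∷ L)     = cong (ltBit y x +_) (countBelow-swapAt x p L)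

countEq-swapAt : ∀ c p L → countEq c (swapAt p L) ≡ countEq c L
countEq-swapAt c zero    []          = refl
countEq-swapAt c zero    (y ∷ [])    = refl
countEq-swapAt c zero    (y ∷ z ∷ L) = x∙yz≈y∙xz (eqBit c z) (eqBit c y) (countEq c L)
countEq-swapAt c (suc p) []          = refl
countEq-swapAt c (suc p) (y ∷ L)     = cong (eqBit c y +_) (countEq-swapAt c p L)

countEq-act : ∀ {k} c (w : List (Fin k)) L → countEq c (act w L) ≡ countEq c L
countEq-act c []      L = refl
countEq-act c (a ∷ w) L = trans (countEq-act c w _) (countEq-swapAt c (toℕ a) L)

inversions-swapAt : ∀ p L → inversions (swapAt p L) ≤ suc (inversions L)
inversions-swapAt zero    []          = n≤1+n _
inversions-swapAt zero    (x ∷ [])    = n≤1+n _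
inversions-swapAt zero    (x ∷ y ∷ L) = begin
    (ltBit x y + countBelow y L) + (countBelow x L + inversions L)
      ≤⟨ +-monoˡ-≤ _ (+-monoˡ-≤ _ (ltBit≤1 x y)) ⟩
    (1 + countBelow y L) + (countBelow x L + inversions L)
      ≡⟨ rearrange (countBelow y L) (countBelow x L) (inversions L) ⟩
    suc (countBelow x L + (countBelow y L + inversions L))
      ≤⟨ s≤s (+-monoˡ-≤ _ (m≤n+m (countBelow x L) (ltBit y x))) ⟩
    suc ((ltBit y x + countBelow x L) + (countBelow y L + inversions L)) ∎
  where
    open ≤-Reasoning
    rearrange : ∀ a b c → (1 + a) + (b + c) ≡ suc (b + (a + c))
    rearrange = solve-∀
inversions-swapAt (suc p) []      = n≤1+n _
inversions-swapAt (suc p) (x ∷ L) = begin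
    countBelow x (swapAt p L) + inversions (swapAt p L)
      ≡⟨ cong (_+ inversions (swapAt p L)) (countBelow-swapAt x p L) ⟩
    countBelow x L + inversions (swapAt p L)
      ≤⟨ +-monoʳ-≤ (countBelow x L) (inversions-swapAt p L) ⟩
    countBelow x L + suc (inversions L)
      ≡⟨ +-suc (countBelow x L) (inversions L) ⟩
    suc (countBelow x L + inversions L) ∎
  where open ≤-Reasoning

inversions-act : ∀ {k} (w : List (Fin k)) L → inversions (act w L) ≤ length w + inversions L
inversions-act []      L = ≤-refl
inversions-act (a ∷ w) L = begin
    inversions (act w (swapAt (toℕ a) L))  ≤⟨ inversions-act w _ ⟩
    length w + inversions (swapAt (toℕ a) L) ≤⟨ +-monoʳ-≤ (length w) (inversions-swapAt (toℕ a) L) ⟩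
    length w + suc (inversions L)            ≡⟨ +-suc (length w) (inversions L) ⟩
    suc (length w + inversions L)            ∎
  where open ≤-Reasoning

τ : ℕ → ℕ → ℕ
τ zero    zero          = 1
τ zero    (suc zero)    = 0
τ zero    (suc (suc x)) = suc (suc x)
τ (suc a) zero          = zero
τ (suc a) (suc x)       = suc (τ a x)

τ-reflects-< : ∀ a y x → τ a y < τ a x → y < x ⊎ (x ≡ a × y ≡ suc a)
τ-reflects-< zero zero          zero          (s≤s ())
τ-reflects-< zero zero          (suc zero)    ()
τ-reflects-< zero zero          (suc (suc x)) _ = inj₁ (s≤s z≤n)
τ-reflects-< zero (suc zero)    zero          _ = inj₂ (refl , refl)
τ-reflects-< zero (suc zero)    (suc zero)    ()
τ-reflects-< zero (suc zero)    (suc (suc x)) _ = inj₁ (s≤s (s≤s z≤n))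
τ-reflects-< zero (suc (suc y)) zero          (s≤s ())
τ-reflects-< zero (suc (suc y)) (suc zero)    ()
τ-reflects-< zero (suc (suc y)) (suc (suc x)) lt = inj₁ lt
τ-reflects-< (suc a) y       zero    ()
τ-reflects-< (suc a) zero    (suc x) _ = inj₁ (s≤s z≤n)
τ-reflects-< (suc a) (suc y) (suc x) (s≤s lt) with τ-reflects-< a y x lt
... | inj₁ y<x           = inj₁ (s≤s y<x)
... | inj₂ (x≡a , y≡a+1) = inj₂ (cong suc x≡a , cong suc y≡a+1)

ltBit-τ : ∀ a y x → ltBit (τ a y) (τ a x) ≤ ltBit y x + eqBit a x * eqBit (suc a) y
ltBit-τ a y x with ltBit-cases (τ a y) (τ a x)
... | inj₁ e rewrite e = z≤n
... | inj₂ (e , lt) rewrite e with τ-reflects-< a y x lt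
...   | inj₁ y<x rewrite ltBit-< y x y<x = s≤s z≤n
...   | inj₂ (refl , refl) rewrite eqBit-refl a = m≤n+m 1 (ltBit (suc a) a)

countBelow-τ : ∀ a x M →
  countBelow (τ a x) (map (τ a) M) ≤ countBelow x M + eqBit a x * countEq (suc a) M
countBelow-τ a x []      = z≤n
countBelow-τ a x (y ∷ M) = begin
    ltBit (τ a y) (τ a x) + countBelow (τ a x) (map (τ a) M)
      ≤⟨ +-mono-≤ (ltBit-τ a y x) (countBelow-τ a x M) ⟩
    (ltBit y x + eqBit a x * eqBit (suc a) y) + (countBelow x M + eqBit a x * countEq (suc a) M)
      ≡⟨ rearrange (ltBit y x) (eqBit a x) (eqBit (suc a) y) (countBelow x M) (countEq (suc a) M) ⟩
    (ltBit y x + countBelow x M) + eqBit a x * (eqBit (suc a) y + countEq (suc a) M) ∎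
  where
    open ≤-Reasoning
    rearrange : ∀ p e f c q → (p + e * f) + (c + e * q) ≡ (p + c) + e * (f + q)
    rearrange = solve-∀

inversions-τ : ∀ a M → inversions (map (τ a) M) ≤ inversions M + countEq a M * countEq (suc a) M
inversions-τ a []      = z≤n
inversions-τ a (x ∷ M) = begin
    countBelow (τ a x) (map (τ a) M) + inversions (map (τ a) M)
      ≤⟨ +-mono-≤ (countBelow-τ a x M) (inversions-τ a M) ⟩
    (countBelow x M + E * C) + (inversions M + A * C)
      ≡⟨ rearrange (countBelow x M) E C (inversions M) A ⟩
    (countBelow x M + inversions M) + (E + A) * C
      ≤⟨ +-monoʳ-≤ (countBelow x M + inversions M) (*-monoʳ-≤ (E + A) (m≤n+m C F)) ⟩
    (countBelow x M + inversions M) + (E + A) * (F + C) ∎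
  where
    open ≤-Reasoning
    E = eqBit a x
    F = eqBit (suc a) x
    A = countEq a M
    C = countEq (suc a) M
    rearrange : ∀ c e q i a → (c + e * q) + (i + a * q) ≡ (c + i) + (e + a) * q
    rearrange = solve-∀

swapAt-map : ∀ (f : ℕ → ℕ) p L → swapAt p (map f L) ≡ map f (swapAt p L)
swapAt-map f zero    []          = refl
swapAt-map f zero    (x ∷ [])    = refl
swapAt-map f zero    (x ∷ y ∷ L) = refl
swapAt-map f (suc p) []          = refl
swapAt-map f (suc p) (x ∷ L)     = cong (f x ∷_) (swapAt-map f p L)

act-map : ∀ {k} (f : ℕ → ℕ) (w : List (Fin k)) L → act w (map f L) ≡ map f (act w L)
act-map f []      L = refl
act-map f (a ∷ w) L = trans (cong (act w) (swapAt-map f (toℕ a) L)) (act-map f w _)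

ascending : ℕ → ℕ → List ℕ
ascending b zero    = []
ascending b (suc n) = b ∷ ascending (suc b) n

identity : ℕ → List ℕ
identity g = ascending 0 (suc g)

perm : ∀ {g} → List (Fin g) → List ℕ
perm {g} w = act w (identity g)

length-ascending : ∀ b n → length (ascending b n) ≡ n
length-ascending b zero    = refl
length-ascending b (suc n) = cong suc (length-ascending (suc b) n)

length-identity : ∀ g → length (identity g) ≡ suc g
length-identity g = length-ascending 0 (suc g)

ascending-snoc : ∀ b n → ascending b (suc n) ≡ ascending b n ++ [ b + n ]
ascending-snoc b zero    = cong [_] (sym (+-identityʳ b))
ascending-snoc b (suc n) = cong (b ∷_)
  (trans (ascending-snoc (suc b) n) (cong (λ m → ascending (suc b) n ++ [ m ]) (sym (+-suc b n))))

ascending-bounded : ∀ b n → All (_< b + n) (ascending b n)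
ascending-bounded b zero    = []
ascending-bounded b (suc n) rewrite +-suc b n = s≤s (m≤m+n b n) ∷ ascending-bounded (suc b) n

countBelow-ascending : ∀ x b n → x ≤ b → countBelow x (ascending b n) ≡ 0
countBelow-ascending x b zero    _   = refl
countBelow-ascending x b (suc n) x≤b rewrite ltBit-≥ b x x≤b = countBelow-ascending x (suc b) n (m≤n⇒m≤1+n x≤b)

inversions-ascending : ∀ b n → inversions (ascending b n) ≡ 0
inversions-ascending b zero    = refl
inversions-ascending b (suc n) rewrite countBelow-ascending b (suc b) n (n≤1+n b) = inversions-ascending (suc b) n

countEq-ascending-above : ∀ c b n → c < b → countEq c (ascending b n) ≡ 0
countEq-ascending-above c b zero    _   = refl
countEq-ascending-above c b (suc n) c<b rewrite eqBit-≢ c b (<⇒≢ c<b) =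
  countEq-ascending-above c (suc b) n (m≤n⇒m≤1+n c<b)

countEq-ascending : ∀ c b n → countEq c (ascending b n) ≤ 1
countEq-ascending c b zero = z≤n
countEq-ascending c b (suc n) with c ≟ b
... | yes refl rewrite eqBit-refl c | countEq-ascending-above c (suc c) n ≤-refl = ≤-refl
... | no c≢b   rewrite eqBit-≢ c b c≢b = countEq-ascending c (suc b) n

τ-fixes-below : ∀ a x → x < a → τ a x ≡ x
τ-fixes-below (suc a) zero    _         = refl
τ-fixes-below (suc a) (suc x) (s≤s x<a) = cong suc (τ-fixes-below a x x<a)

τ-fixes-above : ∀ a x → 2 + a ≤ x → τ a x ≡ x
τ-fixes-above zero    (suc zero)    (s≤s ())
τ-fixes-above zero    (suc (suc x)) _         = refl
τ-fixes-above (suc a) (suc x)       (s≤s a<x) = cong suc (τ-fixes-above a x a<x)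

τ-a : ∀ a → τ a a ≡ suc a
τ-a zero    = refl
τ-a (suc a) = cong suc (τ-a a)

τ-suc-a : ∀ a → τ a (suc a) ≡ a
τ-suc-a zero    = refl
τ-suc-a (suc a) = cong suc (τ-suc-a a)

τ-fixes-ascending : ∀ a b n → 2 + a ≤ b → map (τ a) (ascending b n) ≡ ascending b n
τ-fixes-ascending a b zero    _ = refl
τ-fixes-ascending a b (suc n) a<b = cong₂ _∷_ (τ-fixes-above a b a<b) (τ-fixes-ascending a (suc b) n (m≤n⇒m≤1+n a<b))

swapAt-ascending : ∀ a b n → 2 + a ≤ n → swapAt a (ascending b n) ≡ map (τ (b + a)) (ascending b n)
swapAt-ascending zero b (suc zero) (s≤s ())
swapAt-ascending zero b (suc (suc n)) _ rewrite +-identityʳ b | τ-a b | τ-suc-a b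
  | τ-fixes-ascending b (suc (suc b)) n ≤-refl = refl
swapAt-ascending (suc a) b (suc n) (s≤s a<n) rewrite +-suc b a | τ-fixes-below (suc (b + a)) b (s≤s (m≤m+n b a)) =
  cong (b ∷_) (swapAt-ascending a (suc b) n a<n)

swapAt-snoc : ∀ p L z → suc p < length L → swapAt p (L ++ [ z ]) ≡ swapAt p L ++ [ z ]
swapAt-snoc zero    (x ∷ y ∷ L) z _         = refl
swapAt-snoc zero    (x ∷ [])    z (s≤s ())
swapAt-snoc (suc p) (x ∷ L)     z (s≤s p<L) = cong (x ∷_) (swapAt-snoc p L z p<L)

act-inject : ∀ {g} (u : List (Fin g)) L z → length L ≡ suc g →
  act (map inject₁ u) (L ++ [ z ]) ≡ act u L ++ [ z ]
act-inject []      L z _   = refl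
act-inject (a ∷ u) L z len rewrite toℕ-inject₁ a
  | swapAt-snoc (toℕ a) L z (subst (suc (toℕ a) <_) (sym len) (s≤s (toℕ<n a))) =
  act-inject u (swapAt (toℕ a) L) z (trans (length-swapAt (toℕ a) L) len)

perm-inject : ∀ {g} (s : List (Fin g)) → perm (map inject₁ s) ≡ perm s ++ [ suc g ]
perm-inject {g} s = trans (cong (act (map inject₁ s)) (ascending-snoc 0 (suc g)))
                          (act-inject s (identity g) (suc g) (length-identity g))

length-perm : ∀ {g} (w : List (Fin g)) → length (perm w) ≡ suc g
length-perm {g} w = trans (length-act w (identity g)) (length-identity g)

perm-bounded : ∀ {g} (w : List (Fin g)) → All (_< suc g) (perm w)
perm-bounded {g} w = allAct w (identity g) (ascending-bounded 0 (suc g))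
  where
    allSwapAt : ∀ {P : ℕ → Set} p L → All P L → All P (swapAt p L)
    allSwapAt zero    []          ps             = ps
    allSwapAt zero    (x ∷ [])    ps             = ps
    allSwapAt zero    (x ∷ y ∷ L) (px ∷ py ∷ ps) = py ∷ px ∷ ps
    allSwapAt (suc p) []          ps             = ps
    allSwapAt (suc p) (x ∷ L)     (px ∷ ps)      = px ∷ allSwapAt p L ps
    allAct : ∀ {k} {P : ℕ → Set} (w : List (Fin k)) L → All P L → All P (act w L)
    allAct []      L ps = ps
    allAct (a ∷ w) L ps = allAct w _ (allSwapAt (toℕ a) L ps)

-- A word is reduced if its permutation has as many inversions as the word has letters,
-- i.e. (by inversions-act) no shorter word could produce it.
Reduced : ∀ {g} → List (Fin g) → Set
Reduced w = inversions (perm w) ≡ length w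

inversions-perm : ∀ {g} (u : List (Fin g)) → inversions (perm u) ≤ length u
inversions-perm {g} u = subst (inversions (perm u) ≤_)
  (trans (cong (length u +_) (inversions-ascending 0 (suc g))) (+-identityʳ _)) (inversions-act u (identity g))

Reduced-≈ : ∀ {g} {w w′ : List (Fin g)} → w ≈ w′ → Reduced w → Reduced w′
Reduced-≈ {g} p r = trans (cong inversions (sym (≈-act p (identity g) (length-identity g)))) (trans r (≈-length p))

Reduced-inject : ∀ {g} (s : List (Fin g)) → Reduced (map inject₁ s) → Reduced s
Reduced-inject {g} s r = begin
  inversions (perm s)                        ≡⟨ sym (inversions-snoc (perm s) (perm-bounded s)) ⟩
  inversions (perm s ++ [ suc g ])           ≡⟨ cong inversions (sym (perm-inject s)) ⟩
  inversions (perm (map inject₁ s))          ≡⟨ r ⟩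
  length (map inject₁ s)                     ≡⟨ length-map inject₁ s ⟩
  length s                                   ∎
  where
    open ≡-Reasoning
    countBelow-snoc : ∀ x L z → countBelow x (L ++ [ z ]) ≡ countBelow x L + ltBit z x
    countBelow-snoc x []      z = +-identityʳ _
    countBelow-snoc x (y ∷ L) z rewrite countBelow-snoc x L z = sym (+-assoc (ltBit y x) _ _)
    inversions-snoc : ∀ {z} L → All (_< z) L → inversions (L ++ [ z ]) ≡ inversions L
    inversions-snoc []      []        = refl
    inversions-snoc {z} (x ∷ L) (x<z ∷ ps) rewrite countBelow-snoc x L z | ltBit-≥ z x (<⇒≤ x<z)
      | +-identityʳ (countBelow x L) = cong (countBelow x L +_) (inversions-snoc L ps)

-- Prefixes of reduced words are reduced: the suffix can add at most its length in inversions.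
Reduced-prefix : ∀ {g} (u v : List (Fin g)) → Reduced (u ++ v) → Reduced u
Reduced-prefix {g} u v r = ≤-antisym (inversions-perm u) (+-cancelʳ-≤ (length v) _ _ bound)
  where
    bound : length u + length v ≤ inversions (perm u) + length v
    bound = begin
      length u + length v                      ≡⟨ sym (length-++ u) ⟩
      length (u ++ v)                          ≡⟨ sym r ⟩
      inversions (perm (u ++ v))               ≡⟨ cong inversions (act-++ u v (identity g)) ⟩
      inversions (act v (perm u))              ≤⟨ inversions-act v _ ⟩
      length v + inversions (perm u)           ≡⟨ +-comm (length v) _ ⟩
      inversions (perm u) + length v           ∎
      where open ≤-Reasoning

perm-cons : ∀ {g} (a : Fin g) (w : List (Fin g)) → perm (a ∷ w) ≡ map (τ (toℕ a)) (perm w)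
perm-cons {g} a w = trans (cong (act w) (swapAt-ascending (toℕ a) 0 (suc g) (s≤s (toℕ<n a))))
                          (act-map (τ (toℕ a)) w (identity g))

-- Dropping the first letter of a reduced word leaves a reduced word: the letter relabels the
-- values a, a+1 of the permutation, each occurring once, so it adds at most one inversion.
Reduced-tail : ∀ {g} (a : Fin g) (w : List (Fin g)) → Reduced (a ∷ w) → Reduced w
Reduced-tail {g} a w r = ≤-antisym (inversions-perm w) (≤-pred bound)
  where
    A = toℕ a
    M = perm w
    occurs≤1 : ∀ c → countEq c M ≤ 1
    occurs≤1 c = subst (_≤ 1) (sym (countEq-act c w (identity g))) (countEq-ascending c 0 (suc g))
    bound : suc (length w) ≤ suc (inversions M)
    bound = begin
      suc (length w)                                 ≡⟨ sym r ⟩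
      inversions (perm (a ∷ w))                      ≡⟨ cong inversions (perm-cons a w) ⟩
      inversions (map (τ A) M)                       ≤⟨ inversions-τ A M ⟩
      inversions M + countEq A M * countEq (suc A) M ≤⟨ +-monoʳ-≤ (inversions M) (*-mono-≤ (occurs≤1 A) (occurs≤1 (suc A))) ⟩
      inversions M + 1                               ≡⟨ +-comm (inversions M) 1 ⟩
      suc (inversions M)                             ∎
      where open ≤-Reasoning

Reduced-suffix : ∀ {g} (u v : List (Fin g)) → Reduced (u ++ v) → Reduced v
Reduced-suffix []      v r = r
Reduced-suffix (a ∷ u) v r = Reduced-suffix u v (Reduced-tail a (u ++ v) r)

¬Reduced-square : ∀ {g} (u : List (Fin g)) a → ¬ Reduced (u ++ a ∷ a ∷ [])
¬Reduced-square {g} u a r = 1+n≰n (≤-trans (n≤1+n _) (≤-trans bound (inversions-perm u)))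
  where
    bound : 2 + length u ≤ inversions (perm u)
    bound = begin
      2 + length u                                                   ≡⟨ +-comm 2 (length u) ⟩
      length u + 2                                                   ≡⟨ sym (length-++ u) ⟩
      length (u ++ a ∷ a ∷ [])                                       ≡⟨ sym r ⟩
      inversions (perm (u ++ a ∷ a ∷ []))                            ≡⟨ cong inversions (act-++ u (a ∷ a ∷ []) (identity g)) ⟩
      inversions (swapAt (toℕ a) (swapAt (toℕ a) (perm u)))          ≡⟨ cong inversions (swapAt-involutive (toℕ a) _) ⟩
      inversions (perm u)                                            ∎
      where open ≤-Reasoning

≈-reflexive : ∀ {k} {w w′ : List (Fin k)} → w ≡ w′ → w ≈ w′
≈-reflexive refl = ≈refl

≈-prepend : ∀ {k} (u : List (Fin k)) {v v′} → v ≈ v′ → (u ++ v) ≈ (u ++ v′)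
≈-prepend u (step u′ w {l} {r} rel) =
  subst₂ _≈_ (++-assoc u u′ (l ++ w)) (++-assoc u u′ (r ++ w)) (step (u ++ u′) w rel)
≈-prepend u ≈refl        = ≈refl
≈-prepend u (≈sym p)     = ≈sym (≈-prepend u p)
≈-prepend u (≈trans p q) = ≈trans (≈-prepend u p) (≈-prepend u q)

≈-append : ∀ {k} {v v′ : List (Fin k)} → v ≈ v′ → ∀ u → (v ++ u) ≈ (v′ ++ u)
≈-append (step u′ w {l} {r} rel) u =
  subst₂ _≈_ (sym (trans (++-assoc u′ (l ++ w) u) (cong (u′ ++_) (++-assoc l w u))))
             (sym (trans (++-assoc u′ (r ++ w) u) (cong (u′ ++_) (++-assoc r w u))))
             (step u′ (w ++ u) rel)
≈-append ≈refl        u = ≈refl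
≈-append (≈sym p)     u = ≈sym (≈-append p u)
≈-append (≈trans p q) u = ≈trans (≈-append p u) (≈-append q u)

≈-map : ∀ {k k′} (f : Fin k → Fin k′) →
  (∀ a b → 2 + toℕ a ≤ toℕ b → 2 + toℕ (f a) ≤ toℕ (f b)) →
  (∀ a b → toℕ b ≡ suc (toℕ a) → toℕ (f b) ≡ suc (toℕ (f a))) →
  ∀ {v v′} → v ≈ v′ → map f v ≈ map f v′
≈-map f far adj (step u w {l} {r} rel) =
  subst₂ _≈_ (sym (trans (map-++ f u (l ++ w)) (cong (map f u ++_) (map-++ f l w))))
             (sym (trans (map-++ f u (r ++ w)) (cong (map f u ++_) (map-++ f r w))))
             (step (map f u) (map f w) (mapRel rel))
  where
    mapRel : ∀ {l r} → BraidRel l r → BraidRel (map f l) (map f r)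
    mapRel (comm a b h)  = comm (f a) (f b) (far a b h)
    mapRel (braid a b h) = braid (f a) (f b) (adj a b h)
≈-map f far adj ≈refl        = ≈refl
≈-map f far adj (≈sym p)     = ≈sym (≈-map f far adj p)
≈-map f far adj (≈trans p q) = ≈trans (≈-map f far adj p) (≈-map f far adj q)

≈-inject : ∀ {k} {v v′ : List (Fin k)} → v ≈ v′ → map inject₁ v ≈ map inject₁ v′
≈-inject = ≈-map inject₁
  (λ a b h → subst₂ (λ x y → 2 + x ≤ y) (sym (toℕ-inject₁ a)) (sym (toℕ-inject₁ b)) h)
  (λ a b h → trans (toℕ-inject₁ b) (trans h (cong suc (sym (toℕ-inject₁ a)))))

Far : ∀ {k} → Fin k → Fin k → Set
Far a c = (2 + toℕ a ≤ toℕ c) ⊎ (2 + toℕ c ≤ toℕ a)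

commute-past : ∀ {k} (a : Fin k) (u : List (Fin k)) → All (Far a) u → (u ++ [ a ]) ≈ (a ∷ u)
commute-past a []      []           = ≈refl
commute-past a (c ∷ u) (far ∷ fars) = ≈trans (≈-prepend [ c ] (commute-past a u fars)) (swapFirst far)
  where
    swapFirst : Far a c → (c ∷ a ∷ u) ≈ (a ∷ c ∷ u)
    swapFirst (inj₁ h) = ≈sym (step [] u (comm a c h))
    swapFirst (inj₂ h) = step [] u (comm c a h)

unInject : ∀ {g} (a : Fin (suc g)) → toℕ a < g → ∃ λ a′ → inject₁ a′ ≡ a
unInject a a<g = lower₁ a g≢a , inject₁-lower₁ a g≢a
  where
    g≢a : _ ≢ toℕ a
    g≢a g≡a = <-irrefl (sym g≡a) a<g

All-inject : ∀ {n} (P : ℕ → Set) {u : List (Fin n)} →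
  All (λ c → P (toℕ c)) u → All (λ c → P (toℕ c)) (map inject₁ u)
All-inject P ps = All.map⁺ (All.map (λ {c} → subst P (sym (toℕ-inject₁ c))) ps)

-- descent g j = x_g x_{g-1} ⋯ x_{g-j+1}, the first j letters of down g = x_g ⋯ x_1;
-- descentRest g j is the remaining part of down g.
descent : (g : ℕ) → ℕ → List (Fin g)
descent zero    _       = []
descent (suc g) zero    = []
descent (suc g) (suc j) = fromℕ g ∷ map inject₁ (descent g j)

descentRest : (g : ℕ) → ℕ → List (Fin g)
descentRest zero    _       = []
descentRest (suc g) zero    = down (suc g)
descentRest (suc g) (suc j) = map inject₁ (descentRest g j)

descent-++-rest : ∀ g j → descent g j ++ descentRest g j ≡ down g
descent-++-rest zero    j       = refl
descent-++-rest (suc g) zero    = refl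
descent-++-rest (suc g) (suc j) = cong (fromℕ g ∷_)
  (trans (sym (map-++ inject₁ (descent g j) (descentRest g j))) (cong (map inject₁) (descent-++-rest g j)))

descent-full : ∀ g → descent g g ≡ down g
descent-full zero    = refl
descent-full (suc g) = cong (λ w → fromℕ g ∷ map inject₁ w) (descent-full g)

descent-zero : ∀ g → descent g 0 ≡ []
descent-zero zero    = refl
descent-zero (suc g) = refl

length-descent : ∀ g j → j ≤ g → length (descent g j) ≡ j
length-descent zero    zero    _         = refl
length-descent (suc g) zero    _         = refl
length-descent (suc g) (suc j) (s≤s j≤g) = cong suc (trans (length-map inject₁ (descent g j)) (length-descent g j j≤g))

length-down : ∀ g → length (down g) ≡ g
length-down g = trans (cong length (sym (descent-full g))) (length-descent g g ≤-refl)

descent-bounded : ∀ g j → All (λ c → suc g ≤ toℕ c + j) (descent (suc g) j)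
descent-bounded g zero    = []
descent-bounded g (suc j) = topBound ∷ tailBound g
  where
    topBound : suc g ≤ toℕ (fromℕ g) + suc j
    topBound rewrite toℕ-fromℕ g | +-suc g j = s≤s (m≤m+n g j)
    tailBound : ∀ g → All (λ c → suc g ≤ toℕ c + suc j) (map inject₁ (descent g j))
    tailBound zero    = []
    tailBound (suc g) = All-inject (λ t → suc (suc g) ≤ t + suc j)
      (All.map (λ {c} h → subst (suc (suc g) ≤_) (sym (+-suc (toℕ c) j)) (s≤s h)) (descent-bounded g j))

descent-extend : ∀ g j (a : Fin (suc g)) → toℕ a + j ≡ g → descent (suc g) j ++ [ a ] ≡ descent (suc g) (suc j)
descent-extend g zero a a≡g rewrite descent-zero g =
  cong [_] (toℕ-injective (trans (trans (sym (+-identityʳ _)) a≡g) (sym (toℕ-fromℕ g))))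
descent-extend zero    (suc j) a e = ⊥-elim (1+n≢0 (trans (sym (+-suc (toℕ a) j)) e))
descent-extend (suc g) (suc j) a e with unInject a (subst (toℕ a <_) e (m<m+n (toℕ a) (s≤s z≤n)))
... | a′ , refl = cong (fromℕ (suc g) ∷_) (trans (sym (map-++ inject₁ (descent (suc g) j) [ a′ ]))
      (cong (map inject₁) (descent-extend g j a′ (suc-injective (trans (sym (+-suc (toℕ a′) j)) (e′))))))
  where
    e′ : toℕ a′ + suc j ≡ suc g
    e′ = trans (cong (_+ suc j) (sym (toℕ-inject₁ a′))) e

-- The basic instance of sliding: x_{g+2} x_{g+1} R x_{g+2} = x_{g+1} x_{g+2} x_{g+1} R,
-- where all letters of R are far from x_{g+2}.
descent-slide-top : ∀ g j →
  (descent (2 + g) (2 + j) ++ [ fromℕ (suc g) ]) ≈ (inject₁ (fromℕ g) ∷ descent (2 + g) (2 + j))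
descent-slide-top g j =
  ≈trans (≈-prepend (A ∷ B ∷ []) (commute-past A R farR))
         (≈sym (step [] R (braid B A A≡B+1)))
  where
    A = fromℕ (suc g)
    B = inject₁ (fromℕ g)
    R = map inject₁ (map inject₁ (descent g j))
    A≡B+1 : toℕ A ≡ suc (toℕ B)
    A≡B+1 = trans (toℕ-fromℕ (suc g)) (cong suc (sym (trans (toℕ-inject₁ (fromℕ g)) (toℕ-fromℕ g))))
    farR : All (Far A) R
    farR = All.map (λ {c} c<g → inj₂ (subst (2 + toℕ c ≤_) (sym (toℕ-fromℕ (suc g))) (s≤s c<g)))
                   (All-inject (_< g) (All-inject (_< g) (All.universal toℕ<n (descent g j))))

-- A letter x_{c+1} whose index lies inside a descent slides through it and becomes x_c:
-- (x_{g+1} ⋯ x_{g+2-j}) x_{c+1} = x_c (x_{g+1} ⋯ x_{g+2-j})  whenever g+2-j ≤ c ≤ g.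
descent-slide : ∀ g j (a b : Fin (suc g)) → toℕ a ≡ suc (toℕ b) → 2 + g ≤ toℕ a + j →
  (descent (suc g) j ++ [ a ]) ≈ (b ∷ descent (suc g) j)
descent-slide g zero a b _ big =
  ⊥-elim (1+n≰n (≤-trans (n≤1+n _) (≤-trans big (subst (_≤ g) (sym (+-identityʳ _)) (≤-pred (toℕ<n a))))))
descent-slide g (suc j) a b a≡b+1 big with toℕ a ≟ g
descent-slide zero          (suc j)       a b a≡b+1 big | yes a≡g = ⊥-elim (1+n≢0 (trans (sym a≡b+1) a≡g))
descent-slide (suc g)       (suc zero)    a b a≡b+1 big | yes a≡g =
  ⊥-elim (<-irrefl refl (≤-trans big (≤-reflexive (trans (+-comm (toℕ a) 1) (cong suc a≡g)))))
descent-slide (suc g)       (suc (suc j)) a b a≡b+1 big | yes a≡g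
  with toℕ-injective {i = a} {j = fromℕ (suc g)} (trans a≡g (sym (toℕ-fromℕ (suc g))))
     | toℕ-injective {i = b} {j = inject₁ (fromℕ g)}
         (suc-injective (trans (sym a≡b+1) (trans a≡g (cong suc (sym (trans (toℕ-inject₁ (fromℕ g)) (toℕ-fromℕ g)))))))
... | refl | refl = descent-slide-top g j
descent-slide zero    (suc j) fzero b a≡b+1 big | no a≢g = ⊥-elim (a≢g refl)
descent-slide (suc g) (suc j) a        b a≡b+1 big | no a≢g
  with unInject a (≤∧≢⇒< (≤-pred (toℕ<n a)) a≢g)
... | a′ , refl
  with unInject b (≤-trans (≤-reflexive (sym a≡b+1)) (<⇒≤ (≤∧≢⇒< (≤-pred (toℕ<n (inject₁ a′))) a≢g)))
... | b′ , refl =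
  ≈trans (≈-prepend [ A ] (subst (_≈ map inject₁ (b′ ∷ descent (suc g) j))
                                  (map-++ inject₁ (descent (suc g) j) [ a′ ])
                                  (≈-inject (descent-slide g j a′ b′ a′≡b′+1 big′))))
         (≈sym (step [] (map inject₁ (descent (suc g) j)) (comm (inject₁ b′) A b′-far)))
  where
    A = fromℕ (suc g)
    a′≡b′+1 : toℕ a′ ≡ suc (toℕ b′)
    a′≡b′+1 = trans (sym (toℕ-inject₁ a′)) (trans a≡b+1 (cong suc (toℕ-inject₁ b′)))
    big′ : 2 + g ≤ toℕ a′ + j
    big′ = ≤-pred (subst (3 + g ≤_)
      (trans (+-suc (toℕ (inject₁ a′)) j) (cong (λ t → suc (t + j)) (toℕ-inject₁ a′))) big)
    b′-far : 2 + toℕ (inject₁ b′) ≤ toℕ A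
    b′-far = subst₂ _≤_ (cong suc a≡b+1) (sym (toℕ-fromℕ (suc g)))
      (≤∧≢⇒< (≤-pred (toℕ<n (inject₁ a′))) a≢g)

-- Conjugation by the last row of Δ shifts generators: x_i (x_{g+1} ⋯ x_1) = (x_{g+1} ⋯ x_1) x_{i+1}
-- for 1 ≤ i ≤ g (the special case j = g+1 of descent-slide); down-shift* extends this to words.
down-shift : ∀ g (c : Fin g) → (inject₁ c ∷ down (suc g)) ≈ (down (suc g) ++ [ fsuc c ])
down-shift g c = ≈sym (subst (λ w → (w ++ [ fsuc c ]) ≈ (inject₁ c ∷ w)) (descent-full (suc g))
  (descent-slide g (suc g) (fsuc c) (inject₁ c) (cong suc (sym (toℕ-inject₁ c)))
    (s≤s (subst (suc g ≤_) (+-comm (suc g) (toℕ c)) (m≤m+n (suc g) (toℕ c))))))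

down-shift* : ∀ g (v : List (Fin g)) → (map inject₁ v ++ down (suc g)) ≈ (down (suc g) ++ map fsuc v)
down-shift* g []      = subst (down (suc g) ≈_) (sym (++-identityʳ (down (suc g)))) ≈refl
down-shift* g (c ∷ v) =
  ≈trans (≈-prepend [ inject₁ c ] (down-shift* g v))
  (≈trans (≈-append (down-shift g c) (map fsuc v))
          (≈-reflexive (++-assoc (down (suc g)) [ fsuc c ] (map fsuc v))))

Δ-prefix : ∀ g (s β : List (Fin g)) → (s ++ β) ≈ Δ′ g → ∀ j →
  ((map inject₁ s ++ descent (suc g) j) ++ (descentRest (suc g) j ++ map fsuc β)) ≈ Δ′ (suc g)
Δ-prefix g s β s·β≈Δ j =
  subst (_≈ Δ′ (suc g)) (sym regroup₁)
   (≈trans (≈-prepend (map inject₁ s) (≈sym (down-shift* g β)))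
   (subst (_≈ Δ′ (suc g)) (sym regroup₂) (≈-append (≈-inject s·β≈Δ) D)))
  where
    D = down (suc g)
    regroup₁ : (map inject₁ s ++ descent (suc g) j) ++ (descentRest (suc g) j ++ map fsuc β)
             ≡ map inject₁ s ++ (D ++ map fsuc β)
    regroup₁ = trans (++-assoc (map inject₁ s) (descent (suc g) j) _)
                 (cong (map inject₁ s ++_) (trans (sym (++-assoc (descent (suc g) j) (descentRest (suc g) j) _))
                   (cong (_++ map fsuc β) (descent-++-rest (suc g) j))))
    regroup₂ : map inject₁ s ++ (map inject₁ β ++ D) ≡ map inject₁ (s ++ β) ++ D
    regroup₂ = trans (sym (++-assoc (map inject₁ s) (map inject₁ β) D)) (cong (_++ D) (sym (map-++ inject₁ s β)))

record NormalForm (g : ℕ) (w : List (Fin (suc g))) : Set where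
  constructor normalForm
  field
    lower     : List (Fin g)
    height    : ℕ
    height≤   : height ≤ suc g
    equation  : w ≈ (map inject₁ lower ++ descent (suc g) height)

-- A letter of 0-based index a with a + j = g+1 repeats the last letter of the descent,
-- so appending it to a normal form never gives a reduced word.
repeatLast : ∀ g (s : List (Fin g)) j a → toℕ a + j ≡ suc g →
  ¬ Reduced ((map inject₁ s ++ descent (suc g) j) ++ [ a ])
repeatLast g s zero    a a+j≡g+1 r = <-irrefl refl (subst (_< suc g) (trans (sym (+-identityʳ _)) a+j≡g+1) (toℕ<n a))
repeatLast g s (suc i) a a+j≡g+1 r = ¬Reduced-square (map inject₁ s ++ descent (suc g) i) a (subst Reduced regroup r)
  where
    regroup : (map inject₁ s ++ descent (suc g) (suc i)) ++ [ a ] ≡ (map inject₁ s ++ descent (suc g) i) ++ a ∷ a ∷ []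
    regroup = begin
      (map inject₁ s ++ descent (suc g) (suc i)) ++ [ a ]
        ≡⟨ cong (λ d → (map inject₁ s ++ d) ++ [ a ])
             (sym (descent-extend g i a (suc-injective (trans (sym (+-suc (toℕ a) i)) a+j≡g+1)))) ⟩
      (map inject₁ s ++ (descent (suc g) i ++ [ a ])) ++ [ a ]
        ≡⟨ ++-assoc (map inject₁ s) _ _ ⟩
      map inject₁ s ++ ((descent (suc g) i ++ [ a ]) ++ [ a ])
        ≡⟨ cong (map inject₁ s ++_) (++-assoc (descent (suc g) i) [ a ] [ a ]) ⟩
      map inject₁ s ++ (descent (suc g) i ++ a ∷ a ∷ [])
        ≡⟨ sym (++-assoc (map inject₁ s) (descent (suc g) i) _) ⟩
      (map inject₁ s ++ descent (suc g) i) ++ a ∷ a ∷ [] ∎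
      where open ≡-Reasoning

module AppendLetter (g : ℕ) (s : List (Fin g)) (j : ℕ) (j≤ : j ≤ suc g) where

  W : List (Fin (suc g))
  W = map inject₁ s ++ descent (suc g) j

  absorb : ∀ a (a′ : Fin g) → (descent (suc g) j ++ [ a ]) ≈ (inject₁ a′ ∷ descent (suc g) j) →
           NormalForm g (W ++ [ a ])
  absorb a a′ moved = normalForm (s ++ [ a′ ]) j j≤
    (≈trans (≈-reflexive (++-assoc (map inject₁ s) (descent (suc g) j) [ a ]))
    (≈trans (≈-prepend (map inject₁ s) moved)
            (≈-reflexive (trans (sym (++-assoc (map inject₁ s) [ inject₁ a′ ] (descent (suc g) j)))
                                (cong (_++ descent (suc g) j) (sym (map-++ inject₁ s [ a′ ])))))))

  continue : ∀ a → toℕ a + j ≡ g → NormalForm g (W ++ [ a ])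
  continue a a+j≡g = normalForm s (suc j) (s≤s (subst (j ≤_) a+j≡g (m≤n+m j (toℕ a))))
    (≈-reflexive (trans (++-assoc (map inject₁ s) (descent (suc g) j) [ a ])
                        (cong (map inject₁ s ++_) (descent-extend g j a a+j≡g))))

  -- a + j < g: the letter is far from every letter of the descent and commutes past it.
  commuteLow : ∀ a → suc (toℕ a + j) ≤ g → NormalForm g (W ++ [ a ])
  commuteLow a small with unInject a (≤-trans (s≤s (m≤m+n (toℕ a) j)) small)
  ... | a′ , refl = absorb (inject₁ a′) a′
          (commute-past (inject₁ a′) (descent (suc g) j) (All.map far (descent-bounded g j)))
    where
      far : ∀ {c} → suc g ≤ toℕ c + j → Far (inject₁ a′) c
      far h = inj₁ (+-cancelʳ-≤ j _ _ (≤-trans (s≤s small) h))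

  -- a + j > g+1 (so a = c+1): the letter slides through the descent, arriving as c.
  slideHigh : ∀ c → 2 + g ≤ toℕ (fsuc c) + j → NormalForm g (W ++ [ fsuc c ])
  slideHigh c big = absorb (fsuc c) c (descent-slide g j (fsuc c) (inject₁ c) (cong suc (sym (toℕ-inject₁ c))) big)

  appendLetter : ∀ a → Reduced (W ++ [ a ]) → NormalForm g (W ++ [ a ])
  appendLetter a r with <-cmp (toℕ a + j) g
  ... | tri< small _ _ = commuteLow a small
  ... | tri≈ _ a+j≡g _ = continue a a+j≡g
  ... | tri> _ _ big with toℕ a + j ≟ suc g
  ...   | yes a+j≡g+1 = ⊥-elim (repeatLast g s j a a+j≡g+1 r)
  ...   | no  a+j≢g+1 = high a big a+j≢g+1
    where
      high : ∀ a → g < toℕ a + j → toℕ a + j ≢ suc g → NormalForm g (W ++ [ a ])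
      high fzero    big a+j≢g+1 = ⊥-elim (a+j≢g+1 (≤-antisym j≤ big))
      high (fsuc c) big a+j≢g+1 = slideHigh c (≤∧≢⇒< big (a+j≢g+1 ∘ sym))

NormalForm-≈ : ∀ {g} {w w′ : List (Fin (suc g))} → w ≈ w′ → NormalForm g w′ → NormalForm g w
NormalForm-≈ w≈w′ (normalForm s j j≤ eq) = normalForm s j j≤ (≈trans w≈w′ eq)

normalForm-of : ∀ g (w : List (Fin (suc g))) → Reduced w → NormalForm g w
normalForm-of g w = build (reverseView w)
  where
    build : ∀ {w} → Reverse w → Reduced w → NormalForm g w
    build []                _ = normalForm [] 0 z≤n (≈-reflexive (cong (map inject₁ [] ++_) (sym (descent-zero (suc g)))))
    build (w ∶ view ∶ʳ a) r with build view (Reduced-prefix w [ a ] r)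
    ... | normalForm s j j≤ eq = NormalForm-≈ (≈-append eq [ a ])
            (AppendLetter.appendLetter g s j j≤ a (Reduced-≈ (≈-append eq [ a ]) r))

insertAt : ℕ → ℕ → List ℕ → List ℕ
insertAt zero    z L       = z ∷ L
insertAt (suc p) z []      = [ z ]
insertAt (suc p) z (x ∷ L) = x ∷ insertAt p z L

insertAt-end : ∀ z L → insertAt (length L) z L ≡ L ++ [ z ]
insertAt-end z []      = refl
insertAt-end z (x ∷ L) = cong (x ∷_) (insertAt-end z L)

insertAt-snoc : ∀ p z L y → p ≤ length L → insertAt p z (L ++ [ y ]) ≡ insertAt p z L ++ [ y ]
insertAt-snoc zero    z L       y _         = refl
insertAt-snoc (suc p) z (x ∷ L) y (s≤s p≤L) = cong (x ∷_) (insertAt-snoc p z L y p≤L)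

insertAt-injective : ∀ {z} p p′ L L′ → p ≤ length L → p′ ≤ length L′ → All (_< z) L → All (_< z) L′ →
  insertAt p z L ≡ insertAt p′ z L′ → p ≡ p′ × L ≡ L′
insertAt-injective zero    zero     L       L′       _ _ _ _ e = refl , ∷-injectiveʳ e
insertAt-injective zero    (suc p′) L       (y ∷ L′) _ _ _ (y<z ∷ _) refl = ⊥-elim (<-irrefl refl y<z)
insertAt-injective (suc p) zero     (y ∷ L) L′       _ _ (y<z ∷ _) _ refl = ⊥-elim (<-irrefl refl y<z)
insertAt-injective (suc p) (suc p′) (y ∷ L) (y′ ∷ L′) (s≤s h) (s≤s h′) (_ ∷ bs) (_ ∷ bs′) e
  with ∷-injective e
... | refl , e′ with insertAt-injective p p′ L L′ h h′ bs bs′ e′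
...   | refl , refl = refl , refl

swapAt-last : ∀ (L : List ℕ) y z → swapAt (length L) (L ++ y ∷ z ∷ []) ≡ L ++ z ∷ y ∷ []
swapAt-last []      y z = refl
swapAt-last (x ∷ L) y z = cong (x ∷_) (swapAt-last L y z)

unsnoc : ∀ g (L : List ℕ) → length L ≡ suc g → ∃₂ λ L′ y → L ≡ L′ ++ [ y ] × length L′ ≡ g
unsnoc zero    (x ∷ [])     refl = [] , x , refl , refl
unsnoc (suc g) (x ∷ x′ ∷ L) len with unsnoc g (x′ ∷ L) (suc-injective len)
... | L′ , y , L≡L′y , len′ = x ∷ L′ , y , cong (x ∷_) L≡L′y , cong suc len′

act-descent : ∀ g j L z → j ≤ g → length L ≡ g → act (descent g j) (L ++ [ z ]) ≡ insertAt (g ∸ j) z L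
act-descent zero    zero    [] z _ _   = refl
act-descent (suc g) zero    L  z _ len = sym (trans (cong (λ n → insertAt n z L) (sym len)) (insertAt-end z L))
act-descent (suc g) (suc j) L  z (s≤s j≤g) len with unsnoc g L len
... | L′ , y , refl , len′ = begin
    act (map inject₁ (descent g j)) (swapAt (toℕ (fromℕ g)) ((L′ ++ [ y ]) ++ [ z ]))
      ≡⟨ cong (λ p → act (map inject₁ (descent g j)) (swapAt p ((L′ ++ [ y ]) ++ [ z ]))) (trans (toℕ-fromℕ g) (sym len′)) ⟩
    act (map inject₁ (descent g j)) (swapAt (length L′) ((L′ ++ [ y ]) ++ [ z ]))
      ≡⟨ cong (λ M → act (map inject₁ (descent g j)) (swapAt (length L′) M)) (++-assoc L′ [ y ] [ z ]) ⟩
    act (map inject₁ (descent g j)) (swapAt (length L′) (L′ ++ y ∷ z ∷ []))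
      ≡⟨ cong (act (map inject₁ (descent g j))) (trans (swapAt-last L′ y z) (sym (++-assoc L′ [ z ] [ y ]))) ⟩
    act (map inject₁ (descent g j)) ((L′ ++ [ z ]) ++ [ y ])
      ≡⟨ act-inject (descent g j) (L′ ++ [ z ]) y (trans (length-++ L′) (trans (+-comm (length L′) 1) (cong suc len′))) ⟩
    act (descent g j) (L′ ++ [ z ]) ++ [ y ]
      ≡⟨ cong (_++ [ y ]) (act-descent g j L′ z j≤g len′) ⟩
    insertAt (g ∸ j) z L′ ++ [ y ]
      ≡⟨ sym (insertAt-snoc (g ∸ j) z L′ y (≤-trans (m∸n≤m g j) (≤-reflexive (sym len′)))) ⟩
    insertAt (g ∸ j) z (L′ ++ [ y ]) ∎
  where open ≡-Reasoning

perm-normal : ∀ g (s : List (Fin g)) j → j ≤ suc g →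
  perm (map inject₁ s ++ descent (suc g) j) ≡ insertAt (suc g ∸ j) (suc g) (perm s)
perm-normal g s j j≤ = begin
  perm (map inject₁ s ++ descent (suc g) j)                ≡⟨ act-++ (map inject₁ s) (descent (suc g) j) _ ⟩
  act (descent (suc g) j) (perm (map inject₁ s))            ≡⟨ cong (act (descent (suc g) j)) (perm-inject s) ⟩
  act (descent (suc g) j) (perm s ++ [ suc g ])             ≡⟨ act-descent (suc g) j (perm s) (suc g) j≤ (length-perm s) ⟩
  insertAt (suc g ∸ j) (suc g) (perm s)                     ∎
  where open ≡-Reasoning

perm-normal-injective : ∀ g (s s′ : List (Fin g)) j j′ → j ≤ suc g → j′ ≤ suc g →
  perm (map inject₁ s ++ descent (suc g) j) ≡ perm (map inject₁ s′ ++ descent (suc g) j′) →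
  j ≡ j′ × perm s ≡ perm s′
perm-normal-injective g s s′ j j′ j≤ j′≤ e
  with insertAt-injective (suc g ∸ j) (suc g ∸ j′) (perm s) (perm s′)
         (≤-trans (m∸n≤m (suc g) j) (≤-reflexive (sym (length-perm s))))
         (≤-trans (m∸n≤m (suc g) j′) (≤-reflexive (sym (length-perm s′))))
         (perm-bounded s) (perm-bounded s′)
         (trans (sym (perm-normal g s j j≤)) (trans e (perm-normal g s′ j′ j′≤)))
... | positions , perms = ∸-cancelˡ-≡ j≤ j′≤ positions , perms

countBelow-all : ∀ x M → All (_< x) M → countBelow x M ≡ length M
countBelow-all x []      []           = refl
countBelow-all x (y ∷ M) (y<x ∷ y<xs) rewrite ltBit-< y x y<x = cong suc (countBelow-all x M y<xs)

-- Δ is reduced: each new row x_{g+1} ⋯ x_1 puts the new strand in front, adding g+1 inversions.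
Reduced-Δ : ∀ g → Reduced (Δ′ g)
Reduced-Δ zero    = refl
Reduced-Δ (suc g) = begin
  inversions (perm (map inject₁ (Δ′ g) ++ down (suc g)))
    ≡⟨ cong (λ d → inversions (perm (map inject₁ (Δ′ g) ++ d))) (sym (descent-full (suc g))) ⟩
  inversions (perm (map inject₁ (Δ′ g) ++ descent (suc g) (suc g)))
    ≡⟨ cong inversions (perm-normal g (Δ′ g) (suc g) ≤-refl) ⟩
  inversions (insertAt (suc g ∸ suc g) (suc g) M)
    ≡⟨ cong (λ p → inversions (insertAt p (suc g) M)) (n∸n≡0 (suc g)) ⟩
  countBelow (suc g) M + inversions M
    ≡⟨ cong₂ _+_ (trans (countBelow-all (suc g) M (perm-bounded (Δ′ g))) (length-perm (Δ′ g))) (Reduced-Δ g) ⟩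
  suc g + length (Δ′ g)
    ≡⟨ +-comm (suc g) _ ⟩
  length (Δ′ g) + suc g
    ≡⟨ sym (cong₂ _+_ (length-map inject₁ (Δ′ g)) (length-down (suc g))) ⟩
  length (map inject₁ (Δ′ g)) + length (down (suc g))
    ≡⟨ sym (length-++ (map inject₁ (Δ′ g))) ⟩
  length (map inject₁ (Δ′ g) ++ down (suc g)) ∎
  where
    open ≡-Reasoning
    M = perm (Δ′ g)

sumBelow : (ℕ → ℕ) → ℕ → ℕ
sumBelow φ zero    = 0
sumBelow φ (suc m) = φ 0 + sumBelow (φ ∘ suc) m

-- Fin (sumBelow φ m) is the disjoint union of the Fin (φ u), u < m.
Piece : (ℕ → ℕ) → ℕ → Set
Piece φ m = Σ (Fin m) λ u → Fin (φ (toℕ u))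

joinPiece : ∀ φ m → Piece φ m → Fin (sumBelow φ m)
joinPiece φ (suc m) (fzero  , y) = y ↑ˡ sumBelow (φ ∘ suc) m
joinPiece φ (suc m) (fsuc u , y) = φ 0 ↑ʳ joinPiece (φ ∘ suc) m (u , y)

splitPiece : ∀ φ m → Fin (sumBelow φ m) → Piece φ m
splitPiece φ (suc m) x = [ (λ y → fzero , y) , (λ z → laterPiece (splitPiece (φ ∘ suc) m z)) ]′ (splitAt (φ 0) x)
  where
    laterPiece : Piece (φ ∘ suc) m → Piece φ (suc m)
    laterPiece p = fsuc (proj₁ p) , proj₂ p

splitPiece-joinPiece : ∀ φ m p → splitPiece φ m (joinPiece φ m p) ≡ p
splitPiece-joinPiece φ (suc m) (fzero , y) rewrite splitAt-↑ˡ (φ 0) y (sumBelow (φ ∘ suc) m) = refl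
splitPiece-joinPiece φ (suc m) (fsuc u , y)
  rewrite splitAt-↑ʳ (φ 0) (sumBelow (φ ∘ suc) m) (joinPiece (φ ∘ suc) m (u , y))
        | splitPiece-joinPiece (φ ∘ suc) m (u , y) = refl

joinPiece-splitPiece : ∀ φ m x → joinPiece φ m (splitPiece φ m x) ≡ x
joinPiece-splitPiece φ (suc m) x with splitAt (φ 0) x in eq
... | inj₁ y = splitAt⁻¹-↑ˡ eq
... | inj₂ z = trans (cong (φ 0 ↑ʳ_) (joinPiece-splitPiece (φ ∘ suc) m z)) (splitAt⁻¹-↑ʳ eq)

splitPiece-injective : ∀ φ m {x x′} → splitPiece φ m x ≡ splitPiece φ m x′ → x ≡ x′
splitPiece-injective φ m {x} {x′} e =
  trans (sym (joinPiece-splitPiece φ m x)) (trans (cong (joinPiece φ m) e) (joinPiece-splitPiece φ m x′))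

unshift : ∀ f i j → Fin (shiftZ f i j) → Fin (f (i ∸ j))
unshift f i j y with j ≤ᵇ i
... | true = y

unshift-≤ : ∀ f i j → Fin (shiftZ f i j) → j ≤ i
unshift-≤ f i j y with j ≤ᵇ i in eq
... | true = ≤ᵇ⇒≤ j i (subst T (sym eq) tt)

unshift-injective : ∀ f i j {y y′ : Fin (shiftZ f i j)} → unshift f i j y ≡ unshift f i j y′ → y ≡ y′
unshift-injective f i j e with j ≤ᵇ i
... | true = e

unshift-surjective : ∀ f i j → j ≤ i → (x : Fin (f (i ∸ j))) → ∃ λ y → unshift f i j y ≡ x
unshift-surjective f i j j≤i x with j ≤ᵇ i in eq
... | true  = x , refl
... | false = ⊥-elim (subst T eq (≤⇒≤ᵇ j≤i))

-- δ₀ is the indicator of 0: the length distribution of the divisors of Δ_1 = 1.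
δ₀ : ℕ → ℕ
δ₀ zero    = 1
δ₀ (suc _) = 0

-- divisorCount g i: the number of length-i divisors of Δ over g generators, defined by the
-- recurrence of the corollary: a divisor is a divisor over g generators followed by one of
-- the g+2 descents x_{g+1} ⋯ x_{g+2-j}, 0 ≤ j ≤ g+1.
divisorCount : ℕ → ℕ → ℕ
divisorCount zero    = δ₀
divisorCount (suc g) i = sumBelow (shiftZ (divisorCount g) i) (suc (suc g))

mutual
  representative : (g i : ℕ) → Fin (divisorCount g i) → List (Fin g)
  representative zero    i x = []
  representative (suc g) i x = pieceWord g i (splitPiece (shiftZ (divisorCount g) i) (suc (suc g)) x)

  pieceLower : (g i : ℕ) → Piece (shiftZ (divisorCount g) i) (suc (suc g)) → List (Fin g)
  pieceLower g i (j , y) = representative g (i ∸ toℕ j) (unshift (divisorCount g) i (toℕ j) y)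

  pieceWord : (g i : ℕ) → Piece (shiftZ (divisorCount g) i) (suc (suc g)) → List (Fin (suc g))
  pieceWord g i (j , y) = map inject₁ (pieceLower g i (j , y)) ++ descent (suc g) (toℕ j)

length-representative : ∀ g i x → length (representative g i x) ≡ i
length-representative zero    zero    x = refl
length-representative (suc g) i       x = pieceLength (splitPiece (shiftZ (divisorCount g) i) (suc (suc g)) x)
  where
    pieceLength : ∀ p → length (pieceWord g i p) ≡ i
    pieceLength (j , y) = begin
      length (map inject₁ s ++ descent (suc g) (toℕ j))            ≡⟨ length-++ (map inject₁ s) ⟩
      length (map inject₁ s) + length (descent (suc g) (toℕ j))   ≡⟨ cong₂ _+_ (trans (length-map inject₁ s) (length-representative g _ _))
                                                                                (length-descent (suc g) (toℕ j) (≤-pred (toℕ<n j))) ⟩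
      i ∸ toℕ j + toℕ j                                           ≡⟨ m∸n+n≡m (unshift-≤ (divisorCount g) i (toℕ j) y) ⟩
      i                                                           ∎
      where
        open ≡-Reasoning
        s = pieceLower g i (j , y)

representative-prefix : ∀ g i x → ∃ λ β → (representative g i x ++ β) ≈ Δ′ g
representative-prefix zero    i x = [] , ≈refl
representative-prefix (suc g) i x = piecePrefix (splitPiece (shiftZ (divisorCount g) i) (suc (suc g)) x)
  where
    piecePrefix : ∀ p → ∃ λ β → (pieceWord g i p ++ β) ≈ Δ′ (suc g)
    piecePrefix (j , y) with representative-prefix g (i ∸ toℕ j) (unshift (divisorCount g) i (toℕ j) y)
    ... | β , s·β≈Δ = descentRest (suc g) (toℕ j) ++ map fsuc β , Δ-prefix g _ β s·β≈Δ (toℕ j)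

representative-injective : ∀ g i x x′ → perm (representative g i x) ≡ perm (representative g i x′) → x ≡ x′
representative-injective zero    zero fzero fzero _ = refl
representative-injective (suc g) i    x     x′    e = splitPiece-injective (shiftZ (divisorCount g) i) (suc (suc g)) (pieceInjective _ _ e)
  where
    pieceInjective : ∀ p p′ → perm (pieceWord g i p) ≡ perm (pieceWord g i p′) → p ≡ p′
    pieceInjective (j , y) (j′ , y′) e
      with perm-normal-injective g (pieceLower g i (j , y)) (pieceLower g i (j′ , y′))
             (toℕ j) (toℕ j′) (≤-pred (toℕ<n j)) (≤-pred (toℕ<n j′)) e
    ... | j≡j′ , perms with toℕ-injective j≡j′
    ...   | refl = cong (j ,_) (unshift-injective (divisorCount g) i (toℕ j) (representative-injective g _ _ _ perms))

representative-complete : ∀ g i (w : List (Fin g)) → Reduced w → length w ≡ i →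
  ∃ λ x → w ≈ representative g i x
representative-complete zero    .0 []      _ refl = fzero , ≈refl
representative-complete (suc g) i  w       r len with normalForm-of g w r
... | normalForm s j j≤ w≈nf = fromPiece (fromℕ< (s≤s j≤)) (toℕ-fromℕ< (s≤s j≤))
  where
    F = shiftZ (divisorCount g) i
    reduced-s : Reduced s
    reduced-s = Reduced-inject s (Reduced-prefix (map inject₁ s) (descent (suc g) j) (Reduced-≈ w≈nf r))
    i≡s+j : i ≡ length s + j
    i≡s+j = trans (sym len) (trans (≈-length w≈nf) (trans (length-++ (map inject₁ s))
                  (cong₂ _+_ (length-map inject₁ s) (length-descent (suc g) j j≤))))
    fromPiece : (u : Fin (suc (suc g))) → toℕ u ≡ j → ∃ λ x → w ≈ representative (suc g) i x
    fromPiece u refl with representative-complete g (i ∸ toℕ u) s reduced-s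
                            (sym (trans (cong (_∸ toℕ u) i≡s+j) (m+n∸n≡m (length s) (toℕ u))))
    ... | x₀ , s≈rep with unshift-surjective (divisorCount g) i (toℕ u) (subst (toℕ u ≤_) (sym i≡s+j) (m≤n+m (toℕ u) (length s))) x₀
    ...   | y , unshift-y≡x₀ = joinPiece F (suc (suc g)) (u , y) ,
            ≈trans w≈nf (≈trans (≈-append (≈-inject s≈rep) (descent (suc g) (toℕ u))) (≈-reflexive (sym unfold)))
      where
        unfold : representative (suc g) i (joinPiece F (suc (suc g)) (u , y))
               ≡ map inject₁ (representative g (i ∸ toℕ u) x₀) ++ descent (suc g) (toℕ u)
        unfold = trans (cong (pieceWord g i) (splitPiece-joinPiece F (suc (suc g)) (u , y)))
                       (cong (λ x → map inject₁ (representative g (i ∸ toℕ u) x) ++ descent (suc g) (toℕ u)) unshift-y≡x₀)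

-- Divisors of Δ are reduced, being factors of a reduced word.
divisor-reduced : ∀ g (ω : List (Fin g)) → DivΔ (suc g) ω → Reduced ω
divisor-reduced g ω (α , β , α·ω·β≈Δ) =
  Reduced-prefix ω β (Reduced-suffix α (ω ++ β) (Reduced-≈ (≈sym α·ω·β≈Δ) (Reduced-Δ g)))

divisorCount-correct : ∀ g i → IsDivCount (suc g) i (divisorCount g i)
divisorCount-correct g i = reps , valid , distinct , exhaustive
  where
    reps = tabulate (representative g i)
    valid : ∀ j → (length (lookup reps j) ≡ i) × DivΔ (suc g) (lookup reps j)
    valid j rewrite lookup∘tabulate (representative g i) j =
      length-representative g i j , [] , representative-prefix g i j
    distinct : ∀ j j′ → lookup reps j ≈ lookup reps j′ → j ≡ j′
    distinct j j′ p rewrite lookup∘tabulate (representative g i) j | lookup∘tabulate (representative g i) j′ =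
      representative-injective g i j j′ (≈-act p (identity g) (length-identity g))
    exhaustive : ∀ ω → length ω ≡ i → DivΔ (suc g) ω → ∃ λ j → ω ≈ lookup reps j
    exhaustive ω len div with representative-complete g i ω (divisor-reduced g ω div) len
    ... | x , ω≈rep = x , subst (ω ≈_) (sym (lookup∘tabulate (representative g i) x)) ω≈rep

sum-applyUpTo : ∀ (F h : ℕ → ℕ) m → sum (map F (applyUpTo h m)) ≡ sumBelow (F ∘ h) m
sum-applyUpTo F h zero    = refl
sum-applyUpTo F h (suc m) = cong (F (h 0) +_) (sum-applyUpTo F (h ∘ suc) m)

windowSum-sumBelow : ∀ f i m → windowSum f i m ≡ sumBelow (shiftZ f i) (suc m)
windowSum-sumBelow f i m = sum-applyUpTo (shiftZ f i) (λ u → u) (suc m)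

sumBelow-cong : ∀ φ ψ m → (∀ u → u < m → φ u ≡ ψ u) → sumBelow φ m ≡ sumBelow ψ m
sumBelow-cong φ ψ zero    _  = refl
sumBelow-cong φ ψ (suc m) eq = cong₂ _+_ (eq 0 z<s) (sumBelow-cong (φ ∘ suc) (ψ ∘ suc) m (λ u u<m → eq (suc u) (s<s u<m)))

sumBelow-zero : ∀ φ m → (∀ u → u < m → φ u ≡ 0) → sumBelow φ m ≡ 0
sumBelow-zero φ m zeros = trans (sumBelow-cong φ (λ _ → 0) m zeros) (allZero m)
  where
    allZero : ∀ m → sumBelow (λ _ → 0) m ≡ 0
    allZero zero    = refl
    allZero (suc m) = allZero m

sumBelow-snoc : ∀ φ m → sumBelow φ (suc m) ≡ sumBelow φ m + φ m
sumBelow-snoc φ zero    = +-comm (φ 0) 0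
sumBelow-snoc φ (suc m) = trans (cong (φ 0 +_) (sumBelow-snoc (φ ∘ suc) m)) (sym (+-assoc (φ 0) _ _))

sumBelow-reverse : ∀ φ m → sumBelow φ (suc m) ≡ sumBelow (λ u → φ (m ∸ u)) (suc m)
sumBelow-reverse φ zero    = refl
sumBelow-reverse φ (suc m) = begin
  φ 0 + sumBelow (φ ∘ suc) (suc m)                    ≡⟨ cong (φ 0 +_) (sumBelow-reverse (φ ∘ suc) m) ⟩
  φ 0 + sumBelow (λ u → φ (suc (m ∸ u))) (suc m)      ≡⟨ cong (φ 0 +_) (sumBelow-cong _ _ (suc m) (λ u u≤m → cong φ (sym (+-∸-assoc 1 (≤-pred u≤m))))) ⟩
  φ 0 + sumBelow ψ (suc m)                            ≡⟨ +-comm (φ 0) _ ⟩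
  sumBelow ψ (suc m) + φ 0                            ≡⟨ cong (λ k → sumBelow ψ (suc m) + φ k) (sym (n∸n≡0 (suc m))) ⟩
  sumBelow ψ (suc m) + ψ (suc m)                      ≡⟨ sym (sumBelow-snoc ψ (suc m)) ⟩
  sumBelow ψ (suc (suc m))                            ∎
  where
    open ≡-Reasoning
    ψ = λ u → φ (suc m ∸ u)

shiftZ-≤ : ∀ f i u → u ≤ i → shiftZ f i u ≡ f (i ∸ u)
shiftZ-≤ f i u u≤i with u ≤ᵇ i in eq
... | true  = refl
... | false = ⊥-elim (subst T eq (≤⇒≤ᵇ u≤i))

shiftZ-> : ∀ f i u → i < u → shiftZ f i u ≡ 0
shiftZ-> f i u i<u with u ≤ᵇ i in eq
... | true  = ⊥-elim (<⇒≱ i<u (≤ᵇ⇒≤ u i (subst T (sym eq) tt)))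
... | false = refl

shiftZ-suc : ∀ f i u → shiftZ f (suc i) (suc u) ≡ shiftZ f i u
shiftZ-suc f i zero    = refl
shiftZ-suc f i (suc u) = refl

record SymmetricUnimodal (f : ℕ → ℕ) (N : ℕ) : Set where
  field
    vanishes  : ∀ i → N < i → f i ≡ 0
    symmetric : ∀ i → i ≤ N → f i ≡ f (N ∸ i)
    rising    : ∀ i → suc (i + i) ≤ N → f i ≤ f (suc i)

steps-≤ : ∀ (f : ℕ → ℕ) a b → a ≤ b → (∀ l → a ≤ l → l < b → f l ≤ f (suc l)) → f a ≤ f b
steps-≤ f zero zero    _   _  = ≤-refl
steps-≤ f a    (suc b) a≤b st with m≤n⇒m<n∨m≡n a≤b
... | inj₂ refl       = ≤-refl
... | inj₁ (s≤s a≤b′) = ≤-trans (steps-≤ f a b a≤b′ (λ l a≤l l<b → st l a≤l (m≤n⇒m≤1+n l<b))) (st b a≤b′ ≤-refl)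

⌊n/2⌋-bound : ∀ n → n ≤ suc (⌊ n /2⌋ + ⌊ n /2⌋)
⌊n/2⌋-bound zero          = z≤n
⌊n/2⌋-bound (suc zero)    = ≤-refl
⌊n/2⌋-bound (suc (suc n)) rewrite +-suc ⌊ n /2⌋ ⌊ n /2⌋ = s≤s (s≤s (⌊n/2⌋-bound n))

module _ {f : ℕ → ℕ} {N : ℕ} (su : SymmetricUnimodal f N) where
  open SymmetricUnimodal su

  towardsCentre : ∀ a b → a ≤ b → a + b ≤ N → f a ≤ f b
  towardsCentre a b a≤b a+b≤N with b + b ≤? N
  ... | yes b+b≤N = steps-≤ f a b a≤b (λ l _ l<b → rising l
          (≤-trans (+-monoˡ-≤ l l<b) (≤-trans (+-monoʳ-≤ b (<⇒≤ l<b)) b+b≤N)))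
  ... | no  b+b≰N with m≤n⇒∃[o]m+o≡n (≤-trans (m≤n+m b a) a+b≤N)
  ...   | c , refl = ≤-trans (steps-≤ f a c a≤c st) (≤-reflexive (sym mirror))
    where
      a≤c : a ≤ c
      a≤c = +-cancelʳ-≤ b a c (subst (a + b ≤_) (+-comm b c) a+b≤N)
      c<b : c < b
      c<b = +-cancelˡ-< b c b (≰⇒> b+b≰N)
      st : ∀ l → a ≤ l → l < c → f l ≤ f (suc l)
      st l _ l<c = rising l (≤-trans (+-monoˡ-≤ l l<c)
                     (≤-trans (+-monoʳ-≤ c (<⇒≤ (<-trans l<c c<b))) (≤-reflexive (+-comm c b))))
      mirror : f b ≡ f c
      mirror = trans (symmetric b (m≤m+n b c)) (cong f (m+n∸m≡n b c))

  unimodal : UnimodalUpTo f N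
  unimodal = ⌊ N /2⌋ , increasing , decreasing
    where
      twoHalves≤N : ⌊ N /2⌋ + ⌊ N /2⌋ ≤ N
      twoHalves≤N = ≤-trans (+-monoʳ-≤ ⌊ N /2⌋ (⌊n/2⌋≤⌈n/2⌉ N)) (≤-reflexive (⌊n/2⌋+⌈n/2⌉≡n N))
      increasing : ∀ i j → i ≤ j → j ≤ ⌊ N /2⌋ → f i ≤ f j
      increasing i j i≤j j≤half = towardsCentre i j i≤j (≤-trans (+-mono-≤ (≤-trans i≤j j≤half) j≤half) twoHalves≤N)
      decreasing : ∀ i j → ⌊ N /2⌋ ≤ i → i ≤ j → j ≤ N → f j ≤ f i
      decreasing i j half≤i i≤j j≤N with m≤n⇒m<n∨m≡n i≤j
      ... | inj₂ refl = ≤-refl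
      ... | inj₁ i<j  = subst₂ _≤_ (sym (symmetric j j≤N)) (sym (symmetric i i≤N))
                          (towardsCentre (N ∸ j) (N ∸ i) (∸-monoʳ-≤ N i≤j) mirrored≤N)
        where
          i≤N = ≤-trans i≤j j≤N
          N≤i+j : N ≤ i + j
          N≤i+j = ≤-trans (⌊n/2⌋-bound N)
                    (subst (_≤ i + j) (+-suc ⌊ N /2⌋ ⌊ N /2⌋) (+-mono-≤ half≤i (≤-trans (s≤s half≤i) i<j)))
          mirrored≤N : (N ∸ j) + (N ∸ i) ≤ N
          mirrored≤N = ≤-trans (+-monoˡ-≤ (N ∸ i) (m≤n+o⇒m∸n≤o N j (subst (N ≤_) (+-comm i j) N≤i+j))) (≤-reflexive (m+[n∸m]≡n i≤N))

module WindowSum {f : ℕ → ℕ} {N : ℕ} (m : ℕ) (su : SymmetricUnimodal f N) where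
  open SymmetricUnimodal su

  window : ℕ → ℕ
  window i = sumBelow (shiftZ f i) (suc m)

  M = N + m

  window-vanishes : ∀ i → M < i → window i ≡ 0
  window-vanishes i M<i = sumBelow-zero (shiftZ f i) (suc m) λ u u≤m →
    trans (shiftZ-≤ f i u (≤-trans (≤-pred u≤m) (≤-trans (m≤n+m m N) (<⇒≤ M<i))))
          (vanishes (i ∸ u) (N<i∸u u i (≤-trans (s≤s (+-monoʳ-≤ N (≤-pred u≤m))) M<i)))
    where
      N<i∸u : ∀ u i → N + u < i → N < i ∸ u
      N<i∸u zero    i       N<i   = subst (_< i) (+-identityʳ N) N<i
      N<i∸u (suc u) (suc i) N+u<i = N<i∸u u i (≤-pred (subst (_< suc i) (+-suc N u) N+u<i))

  -- The term leaving the window, f (i-m), is at most the term entering it, f (i+1).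
  leaving≤entering : ∀ i → suc (i + i) ≤ M → shiftZ f i m ≤ f (suc i)
  leaving≤entering i small with m ≤? i
  ... | no  m≰i = subst (_≤ f (suc i)) (sym (shiftZ-> f i m (≰⇒> m≰i))) z≤n
  ... | yes m≤i with m≤n⇒∃[o]m+o≡n m≤i
  ...   | e , refl = subst (_≤ f (suc (m + e))) (sym (trans (shiftZ-≤ f (m + e) m m≤i) (cong f (m+n∸m≡n m e))))
          (towardsCentre su e (suc (m + e)) (≤-trans (m≤n+m e m) (n≤1+n _))
            (+-cancelˡ-≤ m _ _ (subst₂ _≤_ (rearrange m e) (+-comm N m) small)))
    where
      rearrange : ∀ m e → suc (m + e + (m + e)) ≡ m + (e + suc (m + e))
      rearrange = solve-∀

  window-rising : ∀ i → suc (i + i) ≤ M → window i ≤ window (suc i)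
  window-rising i small = begin
    window i                                            ≡⟨ sumBelow-snoc (shiftZ f i) m ⟩
    sumBelow (shiftZ f i) m + shiftZ f i m              ≤⟨ +-monoʳ-≤ (sumBelow (shiftZ f i) m) (leaving≤entering i small) ⟩
    sumBelow (shiftZ f i) m + f (suc i)                 ≡⟨ +-comm _ (f (suc i)) ⟩
    f (suc i) + sumBelow (shiftZ f i) m                 ≡⟨ cong (f (suc i) +_) (sumBelow-cong _ _ m (λ u _ → sym (shiftZ-suc f i u))) ⟩
    f (suc i) + sumBelow (shiftZ f (suc i) ∘ suc) m     ≡⟨⟩
    window (suc i)                                      ∎
    where open ≤-Reasoning

  -- Reflecting i ↦ M - i exchanges the window term at offset b with the one at offset u, u + b = m.
  -- Three cases, according to whether the offset-b term lies before 0, inside [0, N], or after N.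
  reflectBefore : ∀ i u e → shiftZ f i (suc (i + e)) ≡ shiftZ f (N + (u + suc (i + e)) ∸ i) u
  reflectBefore i u e = trans (shiftZ-> f i (suc (i + e)) (s≤s (m≤m+n i e)))
    (sym (trans (cong (λ t → shiftZ f t u) i′≡) (trans (shiftZ-≤ f (u + (N + suc e)) u (m≤m+n u _))
      (trans (cong f (m+n∸m≡n u (N + suc e))) (vanishes _ (m<m+n N z<s))))))
    where
      i′≡ : N + (u + suc (i + e)) ∸ i ≡ u + (N + suc e)
      i′≡ = trans (cong (_∸ i) (rearrange N u i e)) (m+n∸m≡n i (u + (N + suc e)))
        where rearrange : ∀ N u i e → N + (u + suc (i + e)) ≡ i + (u + (N + suc e))
              rearrange = solve-∀

  reflectInside : ∀ u b a c → N ≡ a + c → shiftZ f (b + a) b ≡ shiftZ f (N + (u + b) ∸ (b + a)) u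
  reflectInside u b a c N≡a+c = begin
    shiftZ f (b + a) b                     ≡⟨ shiftZ-≤ f (b + a) b (m≤m+n b a) ⟩
    f (b + a ∸ b)                          ≡⟨ cong f (m+n∸m≡n b a) ⟩
    f a                                    ≡⟨ symmetric a (subst (a ≤_) (sym N≡a+c) (m≤m+n a c)) ⟩
    f (N ∸ a)                              ≡⟨ cong f (trans (cong (_∸ a) N≡a+c) (m+n∸m≡n a c)) ⟩
    f c                                    ≡⟨ cong f (sym (m+n∸n≡m c u)) ⟩
    f (c + u ∸ u)                          ≡⟨ sym (shiftZ-≤ f (c + u) u (m≤n+m u c)) ⟩
    shiftZ f (c + u) u                     ≡⟨ cong (λ t → shiftZ f t u) (sym i′≡) ⟩
    shiftZ f (N + (u + b) ∸ (b + a)) u     ∎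
    where
      open ≡-Reasoning
      i′≡ : N + (u + b) ∸ (b + a) ≡ c + u
      i′≡ = trans (cong (λ t → t + (u + b) ∸ (b + a)) N≡a+c)
                  (trans (cong (_∸ (b + a)) (rearrange a c u b)) (m+n∸m≡n (b + a) (c + u)))
        where rearrange : ∀ a c u b → a + c + (u + b) ≡ (b + a) + (c + u)
              rearrange = solve-∀

  reflectAfter : ∀ u b a t → N < a → N + u ≡ a + t → shiftZ f (b + a) b ≡ shiftZ f (N + (u + b) ∸ (b + a)) u
  reflectAfter u b a t N<a N+u≡a+t = trans (shiftZ-≤ f (b + a) b (m≤m+n b a))
    (trans (cong f (m+n∸m≡n b a)) (trans (vanishes a N<a) (sym (shiftZ-> f _ u i′<u))))
    where
      i′≡ : N + (u + b) ∸ (b + a) ≡ t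
      i′≡ = trans (cong (_∸ (b + a)) (trans (rearrange N u b) (trans (cong (b +_) N+u≡a+t) (sym (+-assoc b a t)))))
                  (m+n∸m≡n (b + a) t)
        where rearrange : ∀ N u b → N + (u + b) ≡ b + (N + u)
              rearrange = solve-∀
      i′<u : N + (u + b) ∸ (b + a) < u
      i′<u = subst (_< u) (sym i′≡) (+-cancelˡ-< N t u (≤-trans (+-monoˡ-≤ t N<a) (≤-reflexive (sym N+u≡a+t))))

  reflectTerm : ∀ i u b → i ≤ N + (u + b) → shiftZ f i b ≡ shiftZ f (N + (u + b) ∸ i) u
  reflectTerm i u b i≤ with b ≤? i
  ... | no b≰i with m≤n⇒∃[o]m+o≡n (≰⇒> b≰i)
  ...   | e , refl = reflectBefore i u e
  reflectTerm i u b i≤ | yes b≤i with m≤n⇒∃[o]m+o≡n b≤i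
  ... | a , refl with a ≤? N
  ...   | yes a≤N with m≤n⇒∃[o]m+o≡n a≤N
  ...     | c , N≡ = reflectInside u b a c (sym N≡)
  reflectTerm i u b i≤ | yes b≤i | a , refl | no a≰N
    with m≤n⇒∃[o]m+o≡n (+-cancelˡ-≤ b a (N + u) (subst (b + a ≤_) (rearrange N u b) i≤))
    where rearrange : ∀ N u b → N + (u + b) ≡ b + (N + u)
          rearrange = solve-∀
  ... | t , a+t≡ = reflectAfter u b a t (≰⇒> a≰N) (sym a+t≡)

  window-symmetric : ∀ i → i ≤ M → window i ≡ window (M ∸ i)
  window-symmetric i i≤M = begin
    window i                                       ≡⟨ sumBelow-reverse (shiftZ f i) m ⟩
    sumBelow (λ u → shiftZ f i (m ∸ u)) (suc m)    ≡⟨ sumBelow-cong _ _ (suc m) reflected ⟩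
    window (M ∸ i)                                 ∎
    where
      open ≡-Reasoning
      reflected : ∀ u → u < suc m → shiftZ f i (m ∸ u) ≡ shiftZ f (M ∸ i) u
      reflected u u≤m with m≤n⇒∃[o]m+o≡n (≤-pred u≤m)
      ... | b , refl = trans (cong (shiftZ f i) (m+n∸m≡n u b)) (reflectTerm i u b i≤M)

  window-symmetricUnimodal : SymmetricUnimodal window M
  window-symmetricUnimodal = record
    { vanishes = window-vanishes ; symmetric = window-symmetric ; rising = window-rising }

top-suc : ∀ g → top (suc (suc g)) ≡ top (suc g) + suc g
top-suc g = begin
  suc (suc g) * suc g / 2              ≡⟨ cong (_/ 2) (expand g) ⟩
  (suc g * g + suc g * 2) / 2          ≡⟨ +-distrib-/-∣ʳ (suc g * g) (n∣m*n (suc g)) ⟩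
  suc g * g / 2 + suc g * 2 / 2        ≡⟨ cong (suc g * g / 2 +_) (m*n/n≡m (suc g) 2) ⟩
  suc g * g / 2 + suc g                ∎
  where
    open ≡-Reasoning
    expand : ∀ g → suc (suc g) * suc g ≡ suc g * g + suc g * 2
    expand = solve-∀

divisorCount-symmetricUnimodal : ∀ g → SymmetricUnimodal (divisorCount g) (top (suc g))
divisorCount-symmetricUnimodal zero    = record
  { vanishes  = λ { (suc i) _ → refl }
  ; symmetric = λ { zero _ → refl }
  ; rising    = λ _ () }
divisorCount-symmetricUnimodal (suc g) = subst (SymmetricUnimodal (divisorCount (suc g))) (sym (top-suc g))
  (WindowSum.window-symmetricUnimodal (suc g) (divisorCount-symmetricUnimodal g))

corollary3p2 : Σ (ℕ → ℕ → ℕ) λ d →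
    ((n i : ℕ) → 1 ≤ n → IsDivCount n i (d n i))
    × ((n : ℕ) → 1 ≤ n → (i : ℕ) → i ≤ top n → d n i ≡ d n (top n ∸ i))
    × ((n : ℕ) → 1 ≤ n → UnimodalUpTo (d n) (top n))
    × (d 1 0 ≡ 1)
    × ((i : ℕ) → ¬ (i ≡ 0) → d 1 i ≡ 0)
    × ((n : ℕ) → 1 ≤ n → (i : ℕ) → d (suc n) i ≡ windowSum (d n) i n)
corollary3p2 = d , counts , symmetric , unimodal′ , refl , vanishes₁ , recurrence
  where
    d : ℕ → ℕ → ℕ
    d n = divisorCount (n ∸ 1)
    counts : (n i : ℕ) → 1 ≤ n → IsDivCount n i (d n i)
    counts (suc g) i _ = divisorCount-correct g i
    symmetric : (n : ℕ) → 1 ≤ n → (i : ℕ) → i ≤ top n → d n i ≡ d n (top n ∸ i)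
    symmetric (suc g) _ = SymmetricUnimodal.symmetric (divisorCount-symmetricUnimodal g)
    unimodal′ : (n : ℕ) → 1 ≤ n → UnimodalUpTo (d n) (top n)
    unimodal′ (suc g) _ = unimodal (divisorCount-symmetricUnimodal g)
    vanishes₁ : (i : ℕ) → ¬ (i ≡ 0) → d 1 i ≡ 0
    vanishes₁ zero    i≢0 = ⊥-elim (i≢0 refl)
    vanishes₁ (suc i) _   = refl
    recurrence : (n : ℕ) → 1 ≤ n → (i : ℕ) → d (suc n) i ≡ windowSum (d n) i n
    recurrence (suc g) _ i = sym (windowSum-sumBelow (divisorCount g) i (suc g))
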